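{- Let $G$ be a connected graph such that $b'(G)\geq \Delta(G)+z$ for some integer $z\geq 0$. Let $uv$ be any edge of $G$ and write $c(u,v)=|N(u)\cap N(v)|$. Then $\min\{d(u),d(v)\}\geq z+1+c(u,v)$ and \[ |E(G)|\geq \frac{|V(G)|\,(2z+2+c(u,v))}{4}\geq \frac{(2z+2+c(u,v))^2}{4}. \]
   Context: All graphs are finite, undirected, without loops or multiple edges. For a vertex $v$, $N(v)$ is its set of neighbors and $d(v)=|N(v)|$; $\Delta(G)$ is the maximum degree. For a nonempty graph $G$ define the integer \[ b'(G)=\min\Big\{\min_{uv\in E(G)}\big(d(u)+d(v)-1-|N(u)\cap N(v)|\big),\ \big\lfloor 4|E(G)|/|V(G)|\big\rfloor-1\Big\}. \] -}

module Defs where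

open import Data.Bool using (Bool; true; false; _∧_)
open import Data.Nat as ℕ using (ℕ; zero; suc; _+_; _*_; _∸_; _⊔_; _<ᵇ_; NonZero)
open import Data.Nat.DivMod using (_/_)
open import Data.Integer as ℤ using (ℤ; +_; _⊓_)
open import Data.Fin using (Fin; toℕ)
open import Data.List using (List; []; _∷_; length; filter; foldr; map; concatMap; allFin)
open import Data.Product using (_×_; _,_)
open import Relation.Binary.PropositionalEquality using (_≡_)
open import Relation.Nullary.Decidable using (Dec)
open import Data.Bool using (T?)

record Graph (n : ℕ) : Set where
  field
    adj : Fin n → Fin n → Bool
    adj-sym : ∀ i j → adj i j ≡ adj j i
    adj-irr : ∀ i → adj i i ≡ false
open Graph public

∣V∣ : ∀ {n} → Graph n → ℕ
∣V∣ {n} _ = n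

countB : ∀ {n} → (Fin n → Bool) → ℕ
countB {n} p = length (filter (λ i → T? (p i)) (allFin n))

deg : ∀ {n} → Graph n → Fin n → ℕ
deg G v = countB (adj G v)

common : ∀ {n} → Graph n → Fin n → Fin n → ℕ
common G u v = countB (λ w → adj G u w ∧ adj G v w)

-- maximum degree Δ(G) (0 for the empty vertex set)
Δ : ∀ {n} → Graph n → ℕ
Δ {n} G = foldr _⊔_ 0 (map (deg G) (allFin n))

edges : ∀ {n} → Graph n → List (Fin n × Fin n)
edges {n} G =
  concatMap (λ i → map (λ j → (i , j))
    (filter (λ j → T? ((toℕ i <ᵇ toℕ j) ∧ adj G i j)) (allFin n)))
    (allFin n)

∣E∣ : ∀ {n} → Graph n → ℕ
∣E∣ G = length (edges G)

b' : ∀ {n} .{{_ : NonZero n}} → Graph n → ℤ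
b' {n} G =
  foldr _⊓_ ((+ ((4 * ∣E∣ G) / n)) ℤ.- (+ 1))
    (map (λ { (u , v) → ((+ (deg G u + deg G v)) ℤ.- (+ 1)) ℤ.- (+ common G u v) }) (edges G))

data Reach {n} (G : Graph n) : Fin n → Fin n → Set where
  here : ∀ {i} → Reach G i i
  step : ∀ {i j k} → adj G i j ≡ true → Reach G j k → Reach G i k

Connected : ∀ {n} → Graph n → Set
Connected {n} G = ∀ (i j : Fin n) → Reach G i j

module Submission where

-- Since b'(G) ≥ Δ + z bounds every edge term, an edge uv has d(u) + d(v) ≥ Δ + z + 1 + c(u,v), and as
-- each degree is at most Δ, both are at least z + 1 + c(u,v). The density term gives
-- ⌊4|E|/n⌋ ≥ Δ + z + 1 ≥ d(u) + z + 1 ≥ 2z + 2 + c(u,v), and inclusion–exclusion on N(u), N(v) gives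
-- n ≥ |N(u) ∪ N(v)| = d(u) + d(v) − c(u,v) ≥ 2z + 2 + c(u,v).

open import Defs
open import Data.Bool using (Bool; true; false; _∧_; _∨_; T; T?; if_then_else_)
open import Data.Bool.Properties using (∧-comm; T-∧; T-≡)
open import Function.Bundles using (module Equivalence)
open import Data.Nat using (ℕ; _+_; _*_; _≤_; _<_; _⊓_; _⊔_; _<ᵇ_; NonZero)
open import Data.Nat.Properties as ℕP using (≤-trans; ≤-reflexive; +-comm; +-assoc; +-cancelˡ-≤; +-cancelʳ-≤; +-mono-≤; +-monoˡ-≤; +-monoʳ-≤; *-monoˡ-≤; *-monoʳ-≤; *-comm; ⊓-glb; <-cmp; module ≤-Reasoning)
open import Data.Nat.DivMod using (_/_; m/n*n≤m)
open import Data.Integer as ℤ using (ℤ; +_) renaming (_≤_ to _≤ℤ_)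
import Data.Integer.Properties as ℤP
import Data.Integer.Tactic.RingSolver as ℤSolver
open import Data.Nat.Tactic.RingSolver using (solve-∀)
open import Data.Fin using (Fin; toℕ)
open import Data.Fin.Properties using (toℕ-injective)
open import Data.List using (List; []; _∷_; length; filter; foldr; map; allFin)
open import Data.List.Properties using (length-filter; length-tabulate; foldr-preservesᵒ)
open import Data.List.Membership.Propositional using (_∈_)
open import Data.List.Membership.Propositional.Properties using (∈-concatMap⁺; ∈-map⁺; ∈-filter⁺; ∈-allFin)
open import Data.List.Relation.Unary.Any as Any using ()
open import Data.Product using (_×_; _,_)
open import Data.Sum using (_⊎_; inj₁; inj₂)
open import Relation.Binary using (tri<; tri≈; tri>)
open import Relation.Binary.PropositionalEquality using (_≡_; refl; sym; trans; cong; cong₂; subst; subst₂; module ≡-Reasoning)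
open import Relation.Nullary using (contradiction)

open import Algebra.Properties.CommutativeSemigroup ℕP.+-commutativeSemigroup using (interchange)

indicator : Bool → ℕ
indicator b = if b then 1 else 0

count : ∀ {n} → (Fin n → Bool) → List (Fin n) → ℕ
count p xs = length (filter (λ i → T? (p i)) xs)

count-∷ : ∀ {n} (p : Fin n → Bool) x xs → count p (x ∷ xs) ≡ indicator (p x) + count p xs
count-∷ p x xs with p x
... | true = refl
... | false = refl

count-cong : ∀ {n} {p q : Fin n → Bool} → (∀ i → p i ≡ q i) → ∀ xs → count p xs ≡ count q xs
count-cong p≗q [] = refl
count-cong {p = p} {q} p≗q (x ∷ xs) = begin
  count p (x ∷ xs)              ≡⟨ count-∷ p x xs ⟩
  indicator (p x) + count p xs  ≡⟨ cong₂ _+_ (cong indicator (p≗q x)) (count-cong p≗q xs) ⟩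
  indicator (q x) + count q xs  ≡⟨ sym (count-∷ q x xs) ⟩
  count q (x ∷ xs)              ∎
  where open ≡-Reasoning

indicator-∨+indicator-∧ : ∀ a b → indicator (a ∨ b) + indicator (a ∧ b) ≡ indicator a + indicator b
indicator-∨+indicator-∧ true true = refl
indicator-∨+indicator-∧ true false = refl
indicator-∨+indicator-∧ false true = refl
indicator-∨+indicator-∧ false false = refl

count-∨+count-∧ : ∀ {n} (p q : Fin n → Bool) xs →
  count (λ w → p w ∨ q w) xs + count (λ w → p w ∧ q w) xs ≡ count p xs + count q xs
count-∨+count-∧ p q [] = refl
count-∨+count-∧ p q (x ∷ xs) = begin
  count p∨q (x ∷ xs) + count p∧q (x ∷ xs)
    ≡⟨ cong₂ _+_ (count-∷ p∨q x xs) (count-∷ p∧q x xs) ⟩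
  (indicator (p x ∨ q x) + count p∨q xs) + (indicator (p x ∧ q x) + count p∧q xs)
    ≡⟨ interchange (indicator (p x ∨ q x)) (count p∨q xs) (indicator (p x ∧ q x)) (count p∧q xs) ⟩
  (indicator (p x ∨ q x) + indicator (p x ∧ q x)) + (count p∨q xs + count p∧q xs)
    ≡⟨ cong₂ _+_ (indicator-∨+indicator-∧ (p x) (q x)) (count-∨+count-∧ p q xs) ⟩
  (indicator (p x) + indicator (q x)) + (count p xs + count q xs)
    ≡⟨ interchange (indicator (p x)) (indicator (q x)) (count p xs) (count q xs) ⟩
  (indicator (p x) + count p xs) + (indicator (q x) + count q xs)
    ≡⟨ sym (cong₂ _+_ (count-∷ p x xs) (count-∷ q x xs)) ⟩
  count p (x ∷ xs) + count q (x ∷ xs) ∎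
  where
  open ≡-Reasoning
  p∨q = λ w → p w ∨ q w
  p∧q = λ w → p w ∧ q w

countB≤n : ∀ {n} (p : Fin n → Bool) → countB p ≤ n
countB≤n {n} p = ≤-trans (length-filter (λ i → T? (p i)) (allFin n)) (≤-reflexive (length-tabulate {n = n} (λ i → i)))

common-sym : ∀ {n} (G : Graph n) u v → common G u v ≡ common G v u
common-sym {n} G u v = count-cong (λ w → ∧-comm (adj G u w) (adj G v w)) (allFin n)

deg+deg≤n+common : ∀ {n} (G : Graph n) u v → deg G u + deg G v ≤ n + common G u v
deg+deg≤n+common {n} G u v = begin
  deg G u + deg G v                                     ≡⟨ sym (count-∨+count-∧ (adj G u) (adj G v) (allFin n)) ⟩
  countB (λ w → adj G u w ∨ adj G v w) + common G u v   ≤⟨ +-monoˡ-≤ (common G u v) (countB≤n _) ⟩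
  n + common G u v                                      ∎
  where open ≤-Reasoning

deg≤Δ : ∀ {n} (G : Graph n) v → deg G v ≤ Δ G
deg≤Δ {n} G v = foldr-preservesᵒ ⊔-presᵒ-≥ 0 (map (deg G) (allFin n))
  (inj₂ (Any.map ≤-reflexive (∈-map⁺ (deg G) (∈-allFin v))))
  where
  ⊔-presᵒ-≥ : ∀ x y → deg G v ≤ x ⊎ deg G v ≤ y → deg G v ≤ x ⊔ y
  ⊔-presᵒ-≥ x y (inj₁ d≤x) = ℕP.m≤n⇒m≤n⊔o y d≤x
  ⊔-presᵒ-≥ x y (inj₂ d≤y) = ℕP.m≤n⇒m≤o⊔n x d≤y

⊓-presᵒ-≤ : ∀ {k} i j → i ≤ℤ k ⊎ j ≤ℤ k → i ℤ.⊓ j ≤ℤ k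
⊓-presᵒ-≤ i j (inj₁ i≤k) = ℤP.i≤j⇒i⊓k≤j j i≤k
⊓-presᵒ-≤ i j (inj₂ j≤k) = ℤP.i≤j⇒k⊓i≤j i j≤k

foldr-⊓≤init : ∀ {A : Set} (f : A → ℤ) e xs → foldr ℤ._⊓_ e (map f xs) ≤ℤ e
foldr-⊓≤init f e xs = foldr-preservesᵒ ⊓-presᵒ-≤ e (map f xs) (inj₁ ℤP.≤-refl)

foldr-⊓≤member : ∀ {A : Set} (f : A → ℤ) e {xs x} → x ∈ xs → foldr ℤ._⊓_ e (map f xs) ≤ℤ f x
foldr-⊓≤member f e {xs} x∈xs = foldr-preservesᵒ ⊓-presᵒ-≤ e (map f xs)
  (inj₂ (Any.map (λ eq → ℤP.≤-reflexive (sym eq)) (∈-map⁺ f x∈xs)))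

+≤⇒≤ : ∀ {m n k} {i : ℤ} → + m ≤ℤ i → i ℤ.+ + k ≡ + n → m + k ≤ n
+≤⇒≤ {k = k} m≤i i+k≡n = ℤP.drop‿+≤+ (ℤP.≤-trans (ℤP.+-monoˡ-≤ (+ k) m≤i) (ℤP.≤-reflexive i+k≡n))

edge∈edges : ∀ {n} (G : Graph n) u v → toℕ u < toℕ v → adj G u v ≡ true → (u , v) ∈ edges G
edge∈edges {n} G u v u<v uv =
  ∈-concatMap⁺ _ (Any.map (λ { refl → ∈-map⁺ (u ,_) (∈-filter⁺ _ (∈-allFin v) u<ᵇv∧uv) }) (∈-allFin u))
  where
  u<ᵇv∧uv : T ((toℕ u <ᵇ toℕ v) ∧ adj G u v)
  u<ᵇv∧uv = Equivalence.from T-∧ (ℕP.<⇒<ᵇ u<v , Equivalence.from T-≡ uv)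

b'≤edge-term : ∀ {n} .{{_ : NonZero n}} (G : Graph n) {m} → + m ≤ℤ b' G →
  ∀ u v → toℕ u < toℕ v → adj G u v ≡ true → m + (1 + common G u v) ≤ deg G u + deg G v
b'≤edge-term G m≤b' u v u<v uv =
  +≤⇒≤ (ℤP.≤-trans m≤b' (foldr-⊓≤member _ _ (edge∈edges G u v u<v uv)))
       (sub-sub-cancel (+ (deg G u + deg G v)) (+ common G u v))
  where
  sub-sub-cancel : ∀ x y → ((x ℤ.- + 1) ℤ.- y) ℤ.+ (+ 1 ℤ.+ y) ≡ x
  sub-sub-cancel = ℤSolver.solve-∀

b'-edge-bound : ∀ {n} .{{_ : NonZero n}} (G : Graph n) {m} → + m ≤ℤ b' G →
  ∀ u v → adj G u v ≡ true → m + (1 + common G u v) ≤ deg G u + deg G v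
b'-edge-bound G {m} m≤b' u v uv with <-cmp (toℕ u) (toℕ v)
... | tri< u<v _ _ = b'≤edge-term G m≤b' u v u<v uv
... | tri≈ _ u≡v _ with refl ← toℕ-injective u≡v = contradiction (trans (sym uv) (adj-irr G u)) λ ()
... | tri> _ _ v<u = subst₂ (λ c d → m + (1 + c) ≤ d) (common-sym G v u) (+-comm (deg G v) (deg G u))
  (b'≤edge-term G m≤b' v u v<u (trans (adj-sym G v u) uv))

b'-density-bound : ∀ {n} .{{_ : NonZero n}} (G : Graph n) {m} → + m ≤ℤ b' G → m + 1 ≤ 4 * ∣E∣ G / n
b'-density-bound {n} G m≤b' =
  +≤⇒≤ (ℤP.≤-trans m≤b' (foldr-⊓≤init _ _ (edges G))) (sub-cancel (+ (4 * ∣E∣ G / n)))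
  where
  sub-cancel : ∀ x → (x ℤ.- + 1) ℤ.+ + 1 ≡ x
  sub-cancel = ℤSolver.solve-∀

≤/⇒*≤ : ∀ {k m} n .{{_ : NonZero n}} → k ≤ m / n → n * k ≤ m
≤/⇒*≤ {k} {m} n k≤m/n = begin
  n * k        ≤⟨ *-monoʳ-≤ n k≤m/n ⟩
  n * (m / n)  ≡⟨ *-comm n (m / n) ⟩
  m / n * n    ≤⟨ m/n*n≤m m n ⟩
  m            ∎
  where open ≤-Reasoning

deg-lower-bound : ∀ {n} .{{_ : NonZero n}} (G : Graph n) z → + (Δ G + z) ≤ℤ b' G →
  ∀ u v → adj G u v ≡ true → z + 1 + common G u v ≤ deg G u ⊓ deg G v
deg-lower-bound G z Δ+z≤b' u v uv = ⊓-glb (≤deg-left u v uv)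
  (subst (λ c → z + 1 + c ≤ deg G v) (common-sym G v u) (≤deg-left v u (trans (adj-sym G v u) uv)))
  where
  open ≤-Reasoning
  reassoc : ∀ d z c → d + (z + 1 + c) ≡ d + z + (1 + c)
  reassoc = solve-∀
  ≤deg-left : ∀ x y → adj G x y ≡ true → z + 1 + common G x y ≤ deg G x
  ≤deg-left x y xy = +-cancelˡ-≤ (Δ G) _ _ (begin
    Δ G + (z + 1 + common G x y)  ≡⟨ reassoc (Δ G) z (common G x y) ⟩
    Δ G + z + (1 + common G x y)  ≤⟨ b'-edge-bound G Δ+z≤b' x y xy ⟩
    deg G x + deg G y             ≤⟨ +-monoʳ-≤ (deg G x) (deg≤Δ G y) ⟩
    deg G x + Δ G                 ≡⟨ +-comm (deg G x) (Δ G) ⟩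
    Δ G + deg G x                 ∎)

2z+2+common≤n : ∀ {n} .{{_ : NonZero n}} (G : Graph n) z → + (Δ G + z) ≤ℤ b' G →
  ∀ u v → adj G u v ≡ true → 2 * z + 2 + common G u v ≤ n
2z+2+common≤n {n} G z Δ+z≤b' u v uv = +-cancelʳ-≤ c (2 * z + 2 + c) n (begin
  2 * z + 2 + c + c            ≡⟨ double z c ⟩
  (z + 1 + c) + (z + 1 + c)    ≤⟨ +-mono-≤ (ℕP.m≤n⊓o⇒m≤n _ _ ≤deg) (ℕP.m≤n⊓o⇒m≤o _ _ ≤deg) ⟩
  deg G u + deg G v            ≤⟨ deg+deg≤n+common G u v ⟩
  n + c                        ∎)
  where
  open ≤-Reasoning
  c = common G u v
  ≤deg = deg-lower-bound G z Δ+z≤b' u v uv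
  double : ∀ a b → 2 * a + 2 + b + b ≡ a + 1 + b + (a + 1 + b)
  double = solve-∀

2z+2+common≤4|E|/n : ∀ {n} .{{_ : NonZero n}} (G : Graph n) z → + (Δ G + z) ≤ℤ b' G →
  ∀ u v → adj G u v ≡ true → 2 * z + 2 + common G u v ≤ 4 * ∣E∣ G / n
2z+2+common≤4|E|/n {n} G z Δ+z≤b' u v uv = begin
  2 * z + 2 + c            ≡⟨ split z c ⟩
  (z + 1 + c) + (z + 1)    ≤⟨ +-monoˡ-≤ (z + 1) (≤-trans ≤deg (deg≤Δ G u)) ⟩
  Δ G + (z + 1)            ≡⟨ sym (+-assoc (Δ G) z 1) ⟩
  Δ G + z + 1              ≤⟨ b'-density-bound G Δ+z≤b' ⟩
  4 * ∣E∣ G / n            ∎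
  where
  open ≤-Reasoning
  c = common G u v
  ≤deg = ℕP.m≤n⊓o⇒m≤n _ _ (deg-lower-bound G z Δ+z≤b' u v uv)
  split : ∀ a b → 2 * a + 2 + b ≡ a + 1 + b + (a + 1)
  split = solve-∀

mainTheorem7 : ∀ (n : ℕ) .{{_ : NonZero n}} (G : Graph n) (z : ℕ) →
    Connected G →
    + (Δ G + z) ≤ℤ b' G →
    ∀ (u v : Fin n) → adj G u v ≡ true →
    (z + 1 + common G u v ≤ deg G u ⊓ deg G v)
    × (n * (2 * z + 2 + common G u v) ≤ 4 * ∣E∣ G)
    × ((2 * z + 2 + common G u v) * (2 * z + 2 + common G u v) ≤ n * (2 * z + 2 + common G u v))
mainTheorem7 n G z _ Δ+z≤b' u v uv =
    deg-lower-bound G z Δ+z≤b' u v uv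
  , ≤/⇒*≤ n (2z+2+common≤4|E|/n G z Δ+z≤b' u v uv)
  , *-monoˡ-≤ _ (2z+2+common≤n G z Δ+z≤b' u v uv)
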